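{- At most $2(|X_\gamma|-1)$ pairs $(v,w)$ with $v\in X_\gamma$ and $\{v,w\}$ an edge of $T$ have $w$ not belonging to a leaf branch.
   Context: Let $T$ be a spanning tree of a connected graph $G=(V,E)$, $d_T(v)$ the degree of $v$ in $T$, $\gamma$ an integer, and $X_\gamma=\{v\in V: d_T(v)\ge\gamma\}$, assumed nonempty. Root $T$ at an arbitrary node of $X_\gamma$. The connected components of $T$ after deleting the nodes of $X_\gamma$ are called branches (rooted at their node closest to the root of $T$). A branch is a leaf branch if no other branch lies in its subtree in the rooted tree $T$, and otherwise an internal branch. -}

module Defs where

open import Data.Nat using (ℕ; _≤_; _*_; _∸_; _+_)
open import Data.Integer as ℤ using (ℤ; +_)
open import Data.Integer.Properties as ℤP using ()
open import Data.Bool using (Bool; true; false; if_then_else_)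
open import Data.Fin using (Fin)
open import Data.List using (List; []; _∷_; length; filter; map; head; last; allFin)
open import Data.Nat.ListAction using (sum)
open import Data.List.Relation.Unary.All using (All)
open import Data.List.Relation.Unary.Linked using (Linked)
open import Data.List.Relation.Unary.Unique.Propositional using (Unique)
open import Data.List.Membership.Propositional using (_∈_)
open import Data.Maybe using (just)
open import Data.Product using (Σ; ∃; _×_; _,_)
open import Relation.Binary.PropositionalEquality using (_≡_; _≢_)
open import Relation.Nullary using (¬_)

Graph : ℕ → Set
Graph n = Fin n → Fin n → Bool

module _ {n : ℕ} (A : Graph n) where

  Adj : Fin n → Fin n → Set
  Adj u v = A u v ≡ true

  IsSimple : Set
  IsSimple = (∀ u v → A u v ≡ A v u) × (∀ u → A u u ≡ false)

  IsPath : Fin n → Fin n → List (Fin n) → Set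
  IsPath a b xs = head xs ≡ just a × last xs ≡ just b × Linked Adj xs × Unique xs

  Connected : Set
  Connected = ∀ a b → ∃ λ xs → IsPath a b xs

  IsCycle : List (Fin n) → Set
  IsCycle xs = 3 ≤ length xs × Linked Adj xs × Unique xs
             × (∀ a b → head xs ≡ just a → last xs ≡ just b → Adj b a)

  Acyclic : Set
  Acyclic = ∀ xs → ¬ IsCycle xs

  IsTree : Set
  IsTree = IsSimple × Connected × Acyclic

  deg : Fin n → ℕ
  deg v = sum (map (λ w → if A v w then 1 else 0) (allFin n))

IsSpanningTree : {n : ℕ} → Graph n → Graph n → Set
IsSpanningTree {n} G T = IsTree T × (∀ u v → Adj T u v → Adj G u v)

module Branches {n : ℕ} (T : Graph n) (γ : ℤ) (r : Fin n) where

  X : Fin n → Set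
  X v = γ ℤ.≤ + deg T v

  cardX : ℕ
  cardX = length (filter (λ v → γ ℤP.≤? + deg T v) (allFin n))

  -- x lies in the subtree of u in T rooted at r:
  -- u lies on the (unique) r–x path of T
  InSubtree : Fin n → Fin n → Set
  InSubtree u x = ∃ λ xs → IsPath T r x xs × u ∈ xs

  SameBranch : Fin n → Fin n → Set
  SameBranch x y = ¬ X x × ¬ X y × ∃ λ xs → IsPath T x y xs × All (λ z → ¬ X z) xs

  IsBranchRoot : Fin n → Fin n → Set
  IsBranchRoot w b = SameBranch w b ×
    (∀ y → SameBranch w y → ∀ ps qs → IsPath T r b ps → IsPath T r y qs → length ps ≤ length qs)

  BranchInSubtree : Fin n → Fin n → Set
  BranchInSubtree b w' = ∀ y → SameBranch w' y → InSubtree b y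

  IsLeafBranch : Fin n → Set
  IsLeafBranch w = ∀ b → IsBranchRoot w b →
    ∀ w' → ¬ X w' → ¬ SameBranch w w' → ¬ BranchInSubtree b w'

  InLeafBranch : Fin n → Set
  InLeafBranch w = ¬ X w × IsLeafBranch w

  Counted : Fin n × Fin n → Set
  Counted (v , w) = X v × Adj T v w × ¬ InLeafBranch w

-- Each vertex of X_γ other than the root r gets two slots, inj₁ x and inj₂ x, and every counted
-- pair (v , w) is charged to a slot, injectively.  If w is the parent of v the pair takes inj₁ v;
-- if w is a child of v in X_γ it takes inj₂ w.  Otherwise w is a child of v outside X_γ; as the
-- branch of w is not a leaf branch, some vertex w′ of another branch lies below it, and the root
-- path of w′ enters the branch of w through an edge x – p with x ∈ X_γ and p in that branch: the
-- pair takes inj₂ x.  Injectivity comes from the uniqueness of parents and from the fact that a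
-- branch is entered from X_γ along a single edge (entry-unique).  The leaf-branch condition is
-- negative, so the charge is only obtained under a double negation; this is harmless because
-- the bound to be proved is decidable.

module Submission where

open import Defs
open import Data.Empty using (⊥; ⊥-elim)
open import Data.Fin using (Fin)
open import Data.Fin.Properties using (_≟_)
import Data.Integer as ℤ
open import Data.Integer using (ℤ)
import Data.Integer.Properties as ℤP
open import Data.List using (List; []; _∷_; _++_; _∷ʳ_; length; filter; reverse; drop; head; last; map; allFin)
open import Data.List.Properties using (filter-notAll; unfold-reverse; length-++; length-map)
open import Data.List.Membership.Propositional using (_∈_; _∉_)
open import Data.List.Membership.Propositional.Properties
  using (∈-filter⁺; ∈-filter⁻; ∈-++⁻; ∈-++⁺ˡ; ∈-++⁺ʳ; ∈-map⁺; ∈-allFin)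
import Data.List.Relation.Binary.Permutation.Setoid as Perm
import Data.List.Relation.Binary.Permutation.Setoid.Properties as PermProps
open import Data.List.Relation.Binary.Subset.Propositional using (_⊆_)
open import Data.List.Relation.Binary.Subset.Propositional.Properties using (∷⁺ʳ; xs⊆ys++xs; All-resp-⊇)
open import Data.List.Relation.Unary.All as All using (All; []; _∷_)
open import Data.List.Relation.Unary.All.Properties using (¬Any⇒All¬; All¬⇒¬Any; ++⁺)
open import Data.List.Relation.Unary.Any as Any using (here; there)
open import Data.List.Relation.Unary.Any.Properties using (reverse⁺; reverse⁻)
open import Data.List.Relation.Unary.Linked using (Linked; [-]; _∷_)
open import Data.List.Relation.Unary.Unique.Propositional using (Unique; []; _∷_)
open import Data.List.Relation.Unary.Unique.Propositional.Properties using (filter⁺; allFin⁺)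
open import Data.Maybe using (just)
open import Data.Maybe.Properties using (just-injective)
open import Data.Nat using (ℕ; _≤_; _*_; _∸_; _+_; z≤n; s≤s)
open import Data.Nat.Properties using (≤-trans; _≤?_; ∸-monoˡ-≤; +-mono-≤; +-identityʳ; module ≤-Reasoning)
open import Data.Product using (∃; ∃₂; _×_; _,_; proj₁; proj₂)
open import Data.Sum using (_⊎_; inj₁; inj₂)
open import Data.Sum.Properties using (≡-dec)
open import Function using (id; _∘_)
open import Relation.Binary.Definitions using (DecidableEquality)
open import Relation.Binary.PropositionalEquality using (_≡_; _≢_; refl; sym; trans; subst; cong; cong₂; setoid)
open import Relation.Nullary using (¬_; ¬?; yes; no)
open import Relation.Nullary.Decidable using (_×-dec_; decidable-stable)
open import Relation.Nullary.Negation using (¬¬-map; ¬¬-Monad)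
open import Relation.Unary using (Decidable)

module _ {A B : Set} (_≟ᴮ_ : DecidableEquality B) {Charge : A → B → Set}
         (charge-injective : ∀ {q q′ s} → Charge q s → Charge q′ s → q ≡ q′) where

  length≤-by-charging : ∀ {ps ys} → Unique ps → All (λ q → ∃ λ s → Charge q s × s ∈ ys) ps →
                        length ps ≤ length ys
  length≤-by-charging {[]} _ _ = z≤n
  length≤-by-charging {q ∷ ps} {ys} (q∉ps ∷ ups) ((s , cs , s∈ys) ∷ charged) =
    ≤-trans (s≤s (length≤-by-charging ups (All.zipWith avoid-s (q∉ps , charged))))
            (filter-notAll (λ t → ¬? (s ≟ᴮ t)) ys (Any.map (λ s≡t s≢t → s≢t s≡t) s∈ys))
    where
    avoid-s : ∀ {q′} → q ≢ q′ × (∃ λ s′ → Charge q′ s′ × s′ ∈ ys) →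
              ∃ λ s′ → Charge q′ s′ × s′ ∈ filter (λ t → ¬? (s ≟ᴮ t)) ys
    avoid-s (q≢q′ , s′ , cs′ , s′∈ys) =
      s′ , cs′ , ∈-filter⁺ (λ t → ¬? (s ≟ᴮ t)) s′∈ys (λ { refl → q≢q′ (charge-injective cs cs′) })

Unique⇒length≤ : ∀ {A : Set} → DecidableEquality A → ∀ {xs ys : List A} →
                 Unique xs → xs ⊆ ys → length xs ≤ length ys
Unique⇒length≤ _≟ᴬ_ u xs⊆ys =
  length≤-by-charging _≟ᴬ_ {Charge = _≡_} (λ { refl refl → refl }) u
                      (All.tabulate (λ x∈xs → _ , refl , xs⊆ys x∈xs))

Unique-reverse : ∀ {A : Set} {xs : List A} → Unique xs → Unique (reverse xs)
Unique-reverse {A} {xs} =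
  PermProps.Unique-resp-↭ (setoid A) (Perm.↭-sym (setoid A) (PermProps.↭-reverse (setoid A) xs))

module Walks {V : Set} (E : V → V → Set) where

  data Walk : V → V → List V → Set where
    stop : ∀ a → Walk a a (a ∷ [])
    _∷_  : ∀ {a b c xs} → E a b → Walk b c xs → Walk a c (a ∷ xs)

  source∈ : ∀ {a b xs} → Walk a b xs → a ∈ xs
  source∈ (stop _) = here refl
  source∈ (_ ∷ _)  = here refl

  target∈ : ∀ {a b xs} → Walk a b xs → b ∈ xs
  target∈ (stop _) = here refl
  target∈ (_ ∷ w)  = there (target∈ w)

  source∉drop1 : ∀ {a b xs} → Walk a b xs → Unique xs → a ∉ drop 1 xs
  source∉drop1 (stop _) _           = λ ()
  source∉drop1 (_ ∷ _)  (a∉xs ∷ _) = All¬⇒¬Any a∉xs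

  head-walk : ∀ {a b xs} → Walk a b xs → head xs ≡ just a
  head-walk (stop _) = refl
  head-walk (_ ∷ _)  = refl

  last-walk : ∀ {a b xs} → Walk a b xs → last xs ≡ just b
  last-walk (stop _)          = refl
  last-walk (_ ∷ stop _)      = refl
  last-walk (e ∷ (e′ ∷ w))    = last-walk (e′ ∷ w)

  linked-walk : ∀ {a b xs} → Walk a b xs → Linked E xs
  linked-walk (stop _)       = [-]
  linked-walk (e ∷ stop _)   = e ∷ [-]
  linked-walk (e ∷ (e′ ∷ w)) = e ∷ linked-walk (e′ ∷ w)

  fromLinked : ∀ {a b} xs → head xs ≡ just a → last xs ≡ just b → Linked E xs → Walk a b xs
  fromLinked (x ∷ [])     refl refl [-]      = stop x
  fromLinked (x ∷ y ∷ xs) refl l    (e ∷ es) = e ∷ fromLinked (y ∷ xs) refl l es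

  length≥2 : ∀ {a b xs} → Walk a b xs → a ≢ b → 2 ≤ length xs
  length≥2 (stop _)      a≢a = ⊥-elim (a≢a refl)
  length≥2 (_ ∷ stop _)  _   = s≤s (s≤s z≤n)
  length≥2 (_ ∷ (_ ∷ _)) _   = s≤s (s≤s z≤n)

  _++ʷ_ : ∀ {a b c xs ys} → Walk a b xs → Walk b c ys → ∃ λ zs → Walk a c zs × zs ⊆ xs ++ ys
  stop a  ++ʷ w′ = _ , w′ , xs⊆ys++xs _ (a ∷ [])
  (e ∷ w) ++ʷ w′ with w ++ʷ w′
  ... | zs , w″ , zs⊆ = _ , e ∷ w″ , ∷⁺ʳ _ zs⊆

  snoc : ∀ {a b c xs} → Walk a b xs → E b c → Walk a c (xs ∷ʳ c)
  snoc (stop _) e′ = e′ ∷ stop _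
  snoc (e ∷ w)  e′ = e ∷ snoc w e′

  reverseʷ : (∀ {a b} → E a b → E b a) → ∀ {a b xs} → Walk a b xs → Walk b a (reverse xs)
  reverseʷ E-sym (stop a) = stop a
  reverseʷ E-sym {xs = a ∷ xs} (e ∷ w) =
    subst (Walk _ _) (sym (unfold-reverse a xs)) (snoc (reverseʷ E-sym w) (E-sym e))

  dropUntil : ∀ {a b c ys} → Walk c b ys → Unique ys → a ∈ ys →
              ∃ λ zs → Walk a b zs × Unique zs × zs ⊆ ys × (a ≡ c ⊎ zs ⊆ drop 1 ys)
  dropUntil (stop _) u       (here refl) = _ , stop _ , u , id , inj₁ refl
  dropUntil (e ∷ w)  u       (here refl) = _ , e ∷ w , u , id , inj₁ refl
  dropUntil (_ ∷ w)  (_ ∷ u) (there a∈)  with dropUntil w u a∈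
  ... | zs , w′ , u′ , zs⊆ , _ = zs , w′ , u′ , there ∘ zs⊆ , inj₂ zs⊆

  module _ (_≟ᵥ_ : DecidableEquality V) where
    open import Data.List.Membership.DecPropositional _≟ᵥ_ using (_∈?_)

    erase : ∀ {a b xs} → Walk a b xs → ∃ λ ys → Walk a b ys × Unique ys × ys ⊆ xs
    erase (stop a) = _ , stop a , [] ∷ [] , id
    erase {a} (e ∷ w) with erase w
    ... | ys , w′ , u , ys⊆ with a ∈? ys
    ...   | yes a∈ys = let zs , w″ , u″ , zs⊆ , _ = dropUntil w′ u a∈ys
                       in zs , w″ , u″ , there ∘ ys⊆ ∘ zs⊆
    ...   | no  a∉ys = _ , e ∷ w′ , ¬Any⇒All¬ ys a∉ys ∷ u , ∷⁺ʳ a ys⊆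

module Tree {n : ℕ} (T : Graph n) (tree : IsTree T) where
  open Walks (Adj T) public
  open import Data.List.Membership.DecPropositional (_≟_ {n}) using (_∈?_)

  adj-sym : ∀ {u v} → Adj T u v → Adj T v u
  adj-sym {u} {v} uv = trans (proj₁ (proj₁ tree) v u) uv

  adj-irrefl : ∀ {u} → ¬ Adj T u u
  adj-irrefl {u} uu with trans (sym uu) (proj₂ (proj₁ tree) u)
  ... | ()

  IsPath⇒Walk : ∀ {a b xs} → IsPath T a b xs → Walk a b xs
  IsPath⇒Walk {xs = xs} (h , l , linked , _) = fromLinked xs h l linked

  Walk⇒IsPath : ∀ {a b xs} → Walk a b xs → Unique xs → IsPath T a b xs
  Walk⇒IsPath w u = head-walk w , last-walk w , linked-walk w , u

  noBypass : ∀ {v a b xs} → Adj T v a → Adj T v b → a ≢ b → Walk a b xs → v ∉ xs → ⊥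
  noBypass {v} va vb a≢b w v∉xs with erase _≟_ w
  ... | ys , w′ , u , ys⊆xs = proj₂ (proj₂ tree) (v ∷ ys)
    (s≤s (length≥2 w′ a≢b) , linked-walk cycle , ¬Any⇒All¬ ys (v∉xs ∘ ys⊆xs) ∷ u , closes)
    where
    cycle : Walk v _ (v ∷ ys)
    cycle = va ∷ w′
    closes : ∀ a′ b′ → head (v ∷ ys) ≡ just a′ → last (v ∷ ys) ≡ just b′ → Adj T b′ a′
    closes _ _ refl l =
      subst (λ z → Adj T z v) (just-injective (trans (sym (last-walk cycle)) l)) (adj-sym vb)

  simpleWalk-unique : ∀ {a b xs ys} → Walk a b xs → Unique xs → Walk a b ys → Unique ys → xs ≡ ys
  simpleWalk-unique (stop _) _ (stop _) _ = refl
  simpleWalk-unique (stop _) _ (_ ∷ w′) (a∉ ∷ _) = ⊥-elim (All¬⇒¬Any a∉ (target∈ w′))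
  simpleWalk-unique (_ ∷ w) (a∉ ∷ _) (stop _) _ = ⊥-elim (All¬⇒¬Any a∉ (target∈ w))
  simpleWalk-unique {a} {xs = _ ∷ xs} {ys = _ ∷ ys}
                    (_∷_ {b = c} e w) (a∉xs ∷ u) (_∷_ {b = c′} e′ w′) (a∉ys ∷ u′) with c ≟ c′
  ... | yes refl = cong (_ ∷_) (simpleWalk-unique w u w′ u′)
  ... | no c≢c′ with w ++ʷ reverseʷ adj-sym w′
  ...   | zs , w″ , zs⊆ = ⊥-elim (noBypass e e′ c≢c′ w″ (avoid ∘ ∈-++⁻ xs ∘ zs⊆))
    where
    avoid : a ∈ xs ⊎ a ∈ reverse ys → ⊥
    avoid (inj₁ a∈xs) = All¬⇒¬Any a∉xs a∈xs
    avoid (inj₂ a∈ys) = All¬⇒¬Any a∉ys (reverse⁻ a∈ys)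

  module Rooted (r : Fin n) where

    RootPath : Fin n → List (Fin n) → Set
    RootPath x xs = Walk x r xs × Unique xs

    rootPath-unique : ∀ {x xs ys} → RootPath x xs → RootPath x ys → xs ≡ ys
    rootPath-unique (w , u) (w′ , u′) = simpleWalk-unique w u w′ u′

    rootPath : ∀ x → ∃ (RootPath x)
    rootPath x with proj₁ (proj₂ tree) x r
    ... | xs , path = xs , IsPath⇒Walk path , proj₂ (proj₂ (proj₂ path))

    rootPath-antisym : ∀ {a b as bs} → RootPath a as → RootPath b bs → a ∈ bs → b ∈ as → a ≡ b
    rootPath-antisym ra (wb , ub) a∈bs b∈as with dropUntil wb ub a∈bs
    ... | _ , _  , _  , _ , inj₁ a≡b = a≡b
    ... | _ , wa , ua , _ , inj₂ as⊆ with rootPath-unique (wa , ua) ra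
    ...   | refl = ⊥-elim (source∉drop1 wb ub (as⊆ b∈as))

    Child : Fin n → Fin n → Set
    Child p x = ∃ λ ps → RootPath p ps × RootPath x (x ∷ ps)

    child : ∀ {p x ps} → Adj T x p → RootPath p ps → x ∉ ps → Child p x
    child xp (w , u) x∉ps = _ , (w , u) , (xp ∷ w , ¬Any⇒All¬ _ x∉ps ∷ u)

    parent-unique : ∀ {p p′ x} → Child p x → Child p′ x → p ≡ p′
    parent-unique (_ , (w , _) , rx) (_ , (w′ , _) , rx′) with rootPath-unique rx rx′
    ... | refl = just-injective (trans (sym (head-walk w)) (head-walk w′))

    reverse-rootPath : ∀ {x xs} → IsPath T r x xs → RootPath x (reverse xs)
    reverse-rootPath path@(_ , _ , _ , u) = reverseʷ adj-sym (IsPath⇒Walk path) , Unique-reverse u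

    child≢root : ∀ {p x} → Child p x → x ≢ r
    child≢root (_ , (w , _) , (_ , x∉ps ∷ _)) refl = All¬⇒¬Any x∉ps (target∈ w)

    child⇒adj : ∀ {p x} → Child p x → Adj T p x
    child⇒adj (_ , (() , _) , (stop _ , _))
    child⇒adj (_ , (w , _) , (xb ∷ w′ , _)) with just-injective (trans (sym (head-walk w′)) (head-walk w))
    ... | refl = adj-sym xb

    edge-orientation : ∀ {v w} → Adj T v w → Child v w ⊎ Child w v
    edge-orientation {v} {w} vw with rootPath v
    ... | vs , (wv , uv) with w ∈? vs
    ...   | no w∉vs = inj₁ (child (adj-sym vw) (wv , uv) w∉vs)
    ...   | yes w∈vs with dropUntil wv uv w∈vs
    ...     | _ , _  , _  , _ , inj₁ refl = ⊥-elim (adj-irrefl vw)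
    ...     | _ , wz , uz , _ , inj₂ zs⊆ = inj₂ (child vw (wz , uz) (source∉drop1 wv uv ∘ zs⊆))

module BranchCharging {n : ℕ} (T : Graph n) (tree : IsTree T) (γ : ℤ) (r : Fin n) where
  open Tree T tree
  open Rooted r
  open Branches T γ r

  X? : Decidable X
  X? v = γ ℤP.≤? ℤ.+ deg T v

  XFree : List (Fin n) → Set
  XFree = All (¬_ ∘ X)

  walk⇒sameBranch : ∀ {x y xs} → Walk x y xs → XFree xs → SameBranch x y
  walk⇒sameBranch w free with erase _≟_ w
  ... | ys , w′ , u , ys⊆ =
    All.lookup free (source∈ w) , All.lookup free (target∈ w) , ys , Walk⇒IsPath w′ u , All-resp-⊇ ys⊆ free

  sameBranch⇒walk : ∀ {x y} → SameBranch x y → ∃ λ xs → Walk x y xs × XFree xs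
  sameBranch⇒walk (_ , _ , xs , path , free) = xs , IsPath⇒Walk path , free

  sameBranch-refl : ∀ {x} → ¬ X x → SameBranch x x
  sameBranch-refl x∉X = walk⇒sameBranch (stop _) (x∉X ∷ [])

  sameBranch-sym : ∀ {x y} → SameBranch x y → SameBranch y x
  sameBranch-sym sb with sameBranch⇒walk sb
  ... | _ , w , free = walk⇒sameBranch (reverseʷ adj-sym w) (All-resp-⊇ reverse⁻ free)

  sameBranch-trans : ∀ {x y z} → SameBranch x y → SameBranch y z → SameBranch x z
  sameBranch-trans sb sb′ with sameBranch⇒walk sb | sameBranch⇒walk sb′
  ... | _ , w , free | _ , w′ , free′ with w ++ʷ w′
  ...   | _ , w″ , zs⊆ = walk⇒sameBranch w″ (All-resp-⊇ zs⊆ (++⁺ free free′))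

  -- The walk from w′ through the branch to w and up to r erases to the root path of w′; v′ lies
  -- on it, but being in X_γ neither in the branch nor at w.
  entry-on-rootPath : ∀ {v′ w w′ vs vs′} → X v′ → RootPath v′ vs′ → RootPath w′ (w′ ∷ vs′) →
                      RootPath w (w ∷ vs) → SameBranch w′ w → v′ ∈ vs
  entry-on-rootPath v′∈X (wv′ , _) rw′ (ww , _) sb with sameBranch⇒walk sb
  ... | qs , q , free with q ++ʷ ww
  ...   | _ , wz , zs⊆ with erase _≟_ wz
  ...     | _ , we , ue , es⊆ with rootPath-unique (we , ue) rw′
  ...       | refl with ∈-++⁻ qs (zs⊆ (es⊆ (there (source∈ wv′))))
  ...         | inj₁ v′∈qs         = ⊥-elim (All.lookup free v′∈qs v′∈X)
  ...         | inj₂ (here refl)   = ⊥-elim (All.lookup free (target∈ q) v′∈X)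
  ...         | inj₂ (there v′∈vs) = v′∈vs

  entry-unique : ∀ {v w v′ w′} → X v → Child v w → X v′ → Child v′ w′ → SameBranch w w′ → w ≡ w′
  entry-unique {w = w} {w′ = w′} v∈X cw@(_ , rv , rw) v′∈X cw′@(_ , rv′ , rw′) sb
    with rootPath-antisym rv rv′ (entry-on-rootPath v∈X rv rw rw′ sb)
                                 (entry-on-rootPath v′∈X rv′ rw′ rw (sameBranch-sym sb))
  ... | refl with w ≟ w′
  ...   | yes w≡w′ = w≡w′
  ...   | no w≢w′ with sameBranch⇒walk sb
  ...     | _ , q , free =
    ⊥-elim (noBypass (child⇒adj cw) (child⇒adj cw′) w≢w′ q (λ v∈q → All.lookup free v∈q v∈X))

  sameBranch-or-exit : ∀ {c b ws} → RootPath c ws → b ∈ ws → ¬ X b →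
                       SameBranch c b ⊎ ∃₂ λ x p → X x × Child p x × SameBranch p b
  sameBranch-or-exit (stop _ , _) (here refl) b∉X = inj₁ (sameBranch-refl b∉X)
  sameBranch-or-exit (_ ∷ _  , _) (here refl) b∉X = inj₁ (sameBranch-refl b∉X)
  sameBranch-or-exit {c} (e ∷ w , c∉ ∷ u) (there b∈) b∉X with sameBranch-or-exit (w , u) b∈ b∉X
  ... | inj₂ found = inj₂ found
  ... | inj₁ sb with X? c
  ...   | yes c∈X = inj₂ (c , _ , c∈X , child e (w , u) (All¬⇒¬Any c∉) , sb)
  ...   | no c∉X  = inj₁ (sameBranch-trans (walk⇒sameBranch (e ∷ stop _) (c∉X ∷ proj₁ sb ∷ [])) sb)

  Slot : Set
  Slot = Fin n ⊎ Fin n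

  data Charge : Fin n × Fin n → Slot → Set where
    up   : ∀ {v w} → X v → Child w v → Charge (v , w) (inj₁ v)
    down : ∀ {v w} → X v → Child v w → X w → Charge (v , w) (inj₂ w)
    exit : ∀ {v w p x} → X v → Child v w → SameBranch w p → Child p x → X x → Charge (v , w) (inj₂ x)

  charge-injective : ∀ {q q′ s} → Charge q s → Charge q′ s → q ≡ q′
  charge-injective (up _ c) (up _ c′) = cong (_ ,_) (parent-unique c c′)
  charge-injective (down _ c _) (down _ c′ _) = cong (_, _) (parent-unique c c′)
  charge-injective (down v∈X c _) (exit _ _ sb c′ _) =
    ⊥-elim (proj₁ (proj₂ sb) (subst X (parent-unique c c′) v∈X))
  charge-injective (exit _ _ sb c _) (down v∈X c′ _) =
    ⊥-elim (proj₁ (proj₂ sb) (subst X (parent-unique c′ c) v∈X))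
  charge-injective (exit v∈X c sb cx _) (exit v′∈X c′ sb′ cx′ _) with parent-unique cx cx′
  ... | refl with entry-unique v∈X c v′∈X c′ (sameBranch-trans sb (sameBranch-sym sb′))
  ...   | refl = cong (_, _) (parent-unique c c′)

  charge-exists : ∀ {q} → Counted q → ¬ ¬ ∃ (Charge q)
  charge-exists {v , w} (v∈X , vw , not-in-leaf) no-charge with edge-orientation vw
  ... | inj₂ cwv = no-charge (_ , up v∈X cwv)
  ... | inj₁ cvw with X? w
  ...   | yes w∈X = no-charge (_ , down v∈X cvw w∈X)
  ...   | no w∉X = not-in-leaf (w∉X , leaf)
    where
    leaf : IsLeafBranch w
    leaf b (w~b , _) w′ w′∉X w≁w′ below with below w′ (sameBranch-refl w′∉X)
    ... | _ , path , b∈ps with sameBranch-or-exit (reverse-rootPath path) (reverse⁺ b∈ps) (proj₁ (proj₂ w~b))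
    ...   | inj₁ w′~b = w≁w′ (sameBranch-trans w~b (sameBranch-sym w′~b))
    ...   | inj₂ (x , p , x∈X , cpx , p~b) =
      no-charge (_ , exit v∈X cvw (sameBranch-trans w~b (sameBranch-sym p~b)) cpx x∈X)

  nonRootX : List (Fin n)
  nonRootX = filter (λ v → X? v ×-dec ¬? (v ≟ r)) (allFin n)

  ∈-nonRootX : ∀ {v} → X v → v ≢ r → v ∈ nonRootX
  ∈-nonRootX v∈X v≢r = ∈-filter⁺ _ (∈-allFin _) (v∈X , v≢r)

  length-nonRootX : X r → length nonRootX ≤ cardX ∸ 1
  length-nonRootX r∈X = ∸-monoˡ-≤ 1 (Unique⇒length≤ _≟_ (r∉ ∷ filter⁺ _ (allFin⁺ n)) r∷nonRootX⊆X)
    where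
    r∉ : All (r ≢_) nonRootX
    r∉ = ¬Any⇒All¬ nonRootX (λ r∈ → proj₂ (proj₂ (∈-filter⁻ _ {xs = allFin n} r∈)) refl)
    r∷nonRootX⊆X : r ∷ nonRootX ⊆ filter X? (allFin n)
    r∷nonRootX⊆X (here refl) = ∈-filter⁺ X? (∈-allFin r) r∈X
    r∷nonRootX⊆X (there v∈) = ∈-filter⁺ X? (∈-allFin _) (proj₁ (proj₂ (∈-filter⁻ _ {xs = allFin n} v∈)))

  slots : List Slot
  slots = map inj₁ nonRootX ++ map inj₂ nonRootX

  charge∈slots : ∀ {q s} → Charge q s → s ∈ slots
  charge∈slots (up v∈X c)         = ∈-++⁺ˡ (∈-map⁺ inj₁ (∈-nonRootX v∈X (child≢root c)))
  charge∈slots (down _ c w∈X)     = ∈-++⁺ʳ (map inj₁ nonRootX) (∈-map⁺ inj₂ (∈-nonRootX w∈X (child≢root c)))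
  charge∈slots (exit _ _ _ c x∈X) = ∈-++⁺ʳ (map inj₁ nonRootX) (∈-map⁺ inj₂ (∈-nonRootX x∈X (child≢root c)))

  length-slots : X r → length slots ≤ 2 * (cardX ∸ 1)
  length-slots r∈X = begin
    length slots                                             ≡⟨ length-++ (map inj₁ nonRootX) ⟩
    length (map inj₁ nonRootX) + length (map inj₂ nonRootX) ≡⟨ cong₂ _+_ (length-map inj₁ nonRootX)
                                                                          (length-map inj₂ nonRootX) ⟩
    length nonRootX + length nonRootX                       ≤⟨ +-mono-≤ bound bound ⟩
    (cardX ∸ 1) + (cardX ∸ 1)                               ≡⟨ cong ((cardX ∸ 1) +_) (sym (+-identityʳ _)) ⟩
    2 * (cardX ∸ 1)                                          ∎
    where
    open ≤-Reasoning
    bound : length nonRootX ≤ cardX ∸ 1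
    bound = length-nonRootX r∈X

lemma6 : (n : ℕ) (G T : Graph n) → IsSimple G → Connected G → IsSpanningTree G T →
    (γ : ℤ) (r : Fin n) → Branches.X T γ r r →
    (ps : List (Fin n × Fin n)) → Unique ps → All (Branches.Counted T γ r) ps →
    length ps ≤ 2 * (Branches.cardX T γ r ∸ 1)
lemma6 n G T _ _ (tree , _) γ r r∈X ps ups counted =
  decidable-stable (_ ≤? _) (¬¬-map bound (All.sequenceM _ ¬¬-Monad (All.map charge-exists counted)))
  where
  open BranchCharging T tree γ r
  bound : All (∃ ∘ Charge) ps → length ps ≤ 2 * (Branches.cardX T γ r ∸ 1)
  bound charged = ≤-trans
    (length≤-by-charging (≡-dec _≟_ _≟_) charge-injective ups
                         (All.map (λ (s , c) → s , c , charge∈slots c) charged))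
    (length-slots r∈X)
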